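{- Let $H$ be a Heyting algebra and $a\in H$. For any $\eta\in H[\iota]$, any $x,y\in\mathcal D_a(H)$ and any $h\in H$: if $h\land x=h\land y$, then $h\land\eta(x)=h\land\eta(y)$.
   Context: $\mathcal D_a(H)=\{d\in H: a\le d\text{ and }(d\to a)=a\}$. $H^{\mathcal D_a(H)}$ is the Heyting algebra of all maps $\mathcal D_a(H)\to H$ with pointwise operations; $H$ is identified with the subalgebra of constant maps. $\iota:\mathcal D_a(H)\to H$ is the inclusion map $\iota(d)=d$, and $H[\iota]\subseteq H^{\mathcal D_a(H)}$ is the subalgebra generated by the constant maps together with $\iota$. -}

module Defs where

open import Level using (Level)
open import Data.Product using (Σ; _×_)
open import Relation.Binary.Lattice.Bundles using (HeytingAlgebra)

module _ {c ℓ₁ ℓ₂ : Level} (H : HeytingAlgebra c ℓ₁ ℓ₂) where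
  open HeytingAlgebra H

  IsDa : Carrier → Carrier → Set (ℓ₁ Level.⊔ ℓ₂)
  IsDa a d = (a ≤ d) × ((d ⇨ a) ≈ a)

  Da : Carrier → Set (c Level.⊔ ℓ₁ Level.⊔ ℓ₂)
  Da a = Σ Carrier (IsDa a)

  data Term : Set c where
    const : Carrier → Term
    var   : Term
    _∧ₜ_  : Term → Term → Term
    _∨ₜ_  : Term → Term → Term
    _⇨ₜ_  : Term → Term → Term

  eval : Term → Carrier → Carrier
  eval (const h) d = h
  eval var d = d
  eval (s ∧ₜ t) d = eval s d ∧ eval t d
  eval (s ∨ₜ t) d = eval s d ∨ eval t d
  eval (s ⇨ₜ t) d = eval s d ⇨ eval t d

  -- H[ι]: the subalgebra of H^{D_a(H)} generated by constants and ι,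
  -- i.e. the maps D_a(H) → H of the form d ↦ eval t d.
  Hι : (a : Carrier) → Set c
  Hι a = Term

  app : {a : Carrier} → Hι a → Da a → Carrier
  app t (d Data.Product., _) = eval t d

-- For fixed h, the relation h ∧ u ≈ h ∧ v is a congruence of the Heyting
-- algebra (the kernel of the relativisation u ↦ h ∧ u to the interval [⊥, h]).
-- Every element of H[ι] is a term in ι with constants from H, so it maps
-- congruent arguments to congruent values.
module Submission where

open import Defs
open import Level using (Level)
open import Relation.Binary.Lattice.Bundles using (HeytingAlgebra)
open import Data.Product using (proj₁; _,_)
import Relation.Binary.Lattice.Properties.HeytingAlgebra as HeytingProperties
import Relation.Binary.Lattice.Properties.MeetSemilattice as MeetProperties
import Relation.Binary.Lattice.Properties.JoinSemilattice as JoinProperties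
import Relation.Binary.Reasoning.PartialOrder as ≤-Reasoning

module Relativisation {c ℓ₁ ℓ₂ : Level} (H : HeytingAlgebra c ℓ₁ ℓ₂) (h : HeytingAlgebra.Carrier H) where
  open HeytingAlgebra H
  open HeytingProperties H using (⇨-eval; ∧-distribˡ-∨-≤)
  open MeetProperties meetSemilattice using (∧-monotonic)
  open JoinProperties joinSemilattice using (∨-monotonic)
  open ≤-Reasoning poset

  ∧-monotonic-under : ∀ {u u′ v v′} → h ∧ u ≤ u′ → h ∧ v ≤ v′ → h ∧ (u ∧ v) ≤ u′ ∧ v′
  ∧-monotonic-under {u} {u′} {v} {v′} u≤u′ v≤v′ = begin
    h ∧ (u ∧ v)           ≤⟨ ∧-greatest (∧-monotonic refl (x∧y≤x u v)) (∧-monotonic refl (x∧y≤y u v)) ⟩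
    (h ∧ u) ∧ (h ∧ v)     ≤⟨ ∧-monotonic u≤u′ v≤v′ ⟩
    u′ ∧ v′               ∎

  ∨-monotonic-under : ∀ {u u′ v v′} → h ∧ u ≤ u′ → h ∧ v ≤ v′ → h ∧ (u ∨ v) ≤ u′ ∨ v′
  ∨-monotonic-under {u} {u′} {v} {v′} u≤u′ v≤v′ = begin
    h ∧ (u ∨ v)           ≤⟨ ∧-distribˡ-∨-≤ h u v ⟩
    (h ∧ u) ∨ (h ∧ v)     ≤⟨ ∨-monotonic u≤u′ v≤v′ ⟩
    u′ ∨ v′               ∎

  ⇨-relax-under : ∀ {u u′ v v′} → h ∧ u′ ≤ u → h ∧ v ≤ v′ → h ∧ (u ⇨ v) ≤ u′ ⇨ v′
  ⇨-relax-under {u} {u′} {v} {v′} u′≤u v≤v′ = transpose-⇨ (begin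
    (h ∧ (u ⇨ v)) ∧ u′    ≤⟨ ∧-greatest below-h (∧-greatest below-⇨ below-u) ⟩
    h ∧ ((u ⇨ v) ∧ u)     ≤⟨ ∧-monotonic refl ⇨-eval ⟩
    h ∧ v                 ≤⟨ v≤v′ ⟩
    v′                    ∎)
    where
    below-h : (h ∧ (u ⇨ v)) ∧ u′ ≤ h
    below-h = trans (x∧y≤x _ _) (x∧y≤x _ _)

    below-⇨ : (h ∧ (u ⇨ v)) ∧ u′ ≤ u ⇨ v
    below-⇨ = trans (x∧y≤x _ _) (x∧y≤y _ _)

    below-u : (h ∧ (u ⇨ v)) ∧ u′ ≤ u
    below-u = trans (∧-monotonic (x∧y≤x _ _) refl) u′≤u

  _≈-under_ : Carrier → Carrier → Set ℓ₁
  u ≈-under v = h ∧ u ≈ h ∧ v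

  ≈-under⇒≤ : ∀ {u v} → u ≈-under v → h ∧ u ≤ v
  ≈-under⇒≤ {u} {v} u≈v = trans (reflexive u≈v) (x∧y≤y h v)

  ≤-under-antisym : ∀ {u v} → h ∧ u ≤ v → h ∧ v ≤ u → u ≈-under v
  ≤-under-antisym u≤v v≤u = antisym (∧-greatest (x∧y≤x _ _) u≤v) (∧-greatest (x∧y≤x _ _) v≤u)

  ≈-under-sym : ∀ {u v} → u ≈-under v → v ≈-under u
  ≈-under-sym = Eq.sym

  ∧-cong-under : ∀ {u u′ v v′} → u ≈-under u′ → v ≈-under v′ → (u ∧ v) ≈-under (u′ ∧ v′)
  ∧-cong-under u≈u′ v≈v′ = ≤-under-antisym
    (∧-monotonic-under (≈-under⇒≤ u≈u′) (≈-under⇒≤ v≈v′))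
    (∧-monotonic-under (≈-under⇒≤ (≈-under-sym u≈u′)) (≈-under⇒≤ (≈-under-sym v≈v′)))

  ∨-cong-under : ∀ {u u′ v v′} → u ≈-under u′ → v ≈-under v′ → (u ∨ v) ≈-under (u′ ∨ v′)
  ∨-cong-under u≈u′ v≈v′ = ≤-under-antisym
    (∨-monotonic-under (≈-under⇒≤ u≈u′) (≈-under⇒≤ v≈v′))
    (∨-monotonic-under (≈-under⇒≤ (≈-under-sym u≈u′)) (≈-under⇒≤ (≈-under-sym v≈v′)))

  ⇨-cong-under : ∀ {u u′ v v′} → u ≈-under u′ → v ≈-under v′ → (u ⇨ v) ≈-under (u′ ⇨ v′)
  ⇨-cong-under u≈u′ v≈v′ = ≤-under-antisym
    (⇨-relax-under (≈-under⇒≤ (≈-under-sym u≈u′)) (≈-under⇒≤ v≈v′))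
    (⇨-relax-under (≈-under⇒≤ u≈u′) (≈-under⇒≤ (≈-under-sym v≈v′)))

  eval-cong-under : ∀ (t : Term H) {x y} → x ≈-under y → eval H t x ≈-under eval H t y
  eval-cong-under (const k) x≈y = Eq.refl
  eval-cong-under var       x≈y = x≈y
  eval-cong-under (s ∧ₜ t)  x≈y = ∧-cong-under (eval-cong-under s x≈y) (eval-cong-under t x≈y)
  eval-cong-under (s ∨ₜ t)  x≈y = ∨-cong-under (eval-cong-under s x≈y) (eval-cong-under t x≈y)
  eval-cong-under (s ⇨ₜ t)  x≈y = ⇨-cong-under (eval-cong-under s x≈y) (eval-cong-under t x≈y)

proposition3p2 : {c ℓ₁ ℓ₂ : Level} (H : HeytingAlgebra c ℓ₁ ℓ₂) (a : HeytingAlgebra.Carrier H)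
    (η : Hι H a) (x y : Da H a) (h : HeytingAlgebra.Carrier H) →
    HeytingAlgebra._≈_ H (HeytingAlgebra._∧_ H h (proj₁ x)) (HeytingAlgebra._∧_ H h (proj₁ y)) →
    HeytingAlgebra._≈_ H (HeytingAlgebra._∧_ H h (app H η x)) (HeytingAlgebra._∧_ H h (app H η y))
proposition3p2 H a η (x , _) (y , _) h = Relativisation.eval-cong-under H h η
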